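{- Let $\theta\in\mathcal{L}$ and let $\Gamma$ be a prestate of the pretableau $\mathcal{P}^\theta$ such that $\mathcal{M},s\models\Gamma$ (i.e., every formula of $\Gamma$ holds at $s$) for some multi-agent epistemic model $\mathcal{M}$ and state $s$ of $\mathcal{M}$. Then $\mathcal{M},s\models\Delta$ for at least one $\Delta\in\mathrm{st}(\Gamma)$.
   Context: Fix a nonempty set $\mathbf{AP}$ of atomic propositions and a finite set $\Sigma$ of agents with at least two elements. The language $\mathcal{L}$: $\varphi ::= p \mid \neg\varphi \mid \varphi_1 \wedge \varphi_2 \mid K_a\varphi \mid D\varphi \mid C\varphi$ ($p\in\mathbf{AP}$, $a\in\Sigma$). A multi-agent epistemic model (MAEM) is $(\Sigma,S,\{R_a\}_{a\in\Sigma},R_D,R_C,L)$ with $S\ne\emptyset$, each $R_a$ and $R_D$ an equivalence relation on $S$, $R_D=\bigcap_a R_a$, $R_C$ the transitive closure of $\bigcup_a R_a$, $L:S\to\mathcal{P}(\mathbf{AP})$; satisfaction is standard ($K_a$, $D$, $C$ are box modalities for $R_a$, $R_D$, $R_C$). A set $\Delta\subseteq\mathcal{L}$ is fully expanded if: $\neg\neg\varphi\in\Delta\Rightarrow\varphi\in\Delta$; $\varphi\wedge\psi\in\Delta\Rightarrow\varphi,\psi\in\Delta$; $\neg(\varphi\wedge\psi)\in\Delta\Rightarrow\neg\varphi\in\Delta$ or $\neg\psi\in\Delta$; $K_a\varphi\in\Delta\Rightarrow D\varphi\in\Delta$; $D\varphi\in\Delta\Rightarrow\varphi\in\Delta$;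 $C\varphi\in\Delta\Rightarrow K_a(\varphi\wedge C\varphi)\in\Delta$ for all $a$; $\neg C\varphi\in\Delta\Rightarrow\neg K_a(\varphi\wedge C\varphi)\in\Delta$ for some $a$; and if $\varphi\in\Delta$ and $\psi$ is a subformula of $\varphi$ of the form $K_a\chi$ or $D\chi$, then $\psi\in\Delta$ or $\neg\psi\in\Delta$. For a set $\Gamma$, $\mathrm{st}(\Gamma)$ is the set of minimal fully expanded extensions of $\Gamma$, i.e., fully expanded $\Delta\supseteq\Gamma$ such that no fully expanded $\Delta'$ satisfies $\Gamma\subseteq\Delta'\subsetneq\Delta$. The pretableau $\mathcal{P}^\theta$ is the graph whose nodes are finite sets of formulas of two kinds, prestates and states, built as follows (equal sets of the same kind are never duplicated). Start with the prestate $\{\theta\}$. Rule SR: for each prestate $\Gamma$, add every $\Delta\in\mathrm{st}(\Gamma)$ as a state with an unmarked edge $\Gamma\Rightarrow\Delta$. Rule KR: for each state $\Delta$ containing no pair $\chi,\neg\chi$ and each $\neg K_a\varphi\in\Delta$, add the prestate $\{\neg\varphi\}\cup\{K_a\psi: K_a\psi\in\Delta\}\cup\{\neg K_a\psi:\neg K_a\psi\in\Delta\}$ and a marked edge from $\Delta$ to it labeled $\neg K_a\varphi$. Rule DR: for each state $\Delta$ containing no pair $\chi,\neg\chi$ and each $\neg D\varphi\in\Delta$, add the prestate $\{\neg\varphi\}\cup\{D\psi:D\psi\in\Delta\}\cup\{\neg D\psi:\neg D\psi\in\Delta\}\cup\{K_b\chi:K_b\chi\in\Delta,b\in\Sigma\}\cup\{\neg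 K_b\chi:\neg K_b\chi\in\Delta,b\in\Sigma\}$ and a marked edge labeled $\neg D\varphi$. These rules are applied until no new nodes or edges arise. -}

module Defs where

open import Data.Nat using (ℕ)
open import Data.Fin using (Fin)
open import Data.List using (List; []; _∷_)
open import Data.List.Membership.Propositional using (_∈_)
open import Data.Product using (Σ; ∃; _×_)
open import Data.Sum using (_⊎_)
open import Relation.Nullary using (¬_)
open import Relation.Binary.PropositionalEquality using (_≡_)
open import Relation.Binary.Structures using (IsEquivalence)
open import Relation.Binary.Construct.Closure.Transitive using (TransClosure)

module _ (AP : Set) (n : ℕ) where

  -- Agents are Fin n (the set Σ); atomic propositions are AP.
  data Fm : Set where
    atom : AP → Fm
    ~_   : Fm → Fm
    _∧_  : Fm → Fm → Fm
    K    : Fin n → Fm → Fm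
    D    : Fm → Fm
    C    : Fm → Fm

  -- Finite sets of formulas, represented by lists (up to membership).
  _⊆_ : List Fm → List Fm → Set
  Γ ⊆ Δ = ∀ {φ} → φ ∈ Γ → φ ∈ Δ

  data Sub : Fm → Fm → Set where
    here : ∀ {φ} → Sub φ φ
    sub~ : ∀ {ψ φ} → Sub ψ φ → Sub ψ (~ φ)
    sub∧ˡ : ∀ {ψ φ χ} → Sub ψ φ → Sub ψ (φ ∧ χ)
    sub∧ʳ : ∀ {ψ φ χ} → Sub ψ χ → Sub ψ (φ ∧ χ)
    subK : ∀ {ψ φ a} → Sub ψ φ → Sub ψ (K a φ)
    subD : ∀ {ψ φ} → Sub ψ φ → Sub ψ (D φ)
    subC : ∀ {ψ φ} → Sub ψ φ → Sub ψ (C φ)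

  data IsKD : Fm → Set where
    isK : ∀ {a χ} → IsKD (K a χ)
    isD : ∀ {χ} → IsKD (D χ)

  record FullyExpanded (Δ : List Fm) : Set where
    field
      fe-~~  : ∀ {φ} → (~ (~ φ)) ∈ Δ → φ ∈ Δ
      fe-∧   : ∀ {φ ψ} → (φ ∧ ψ) ∈ Δ → φ ∈ Δ × ψ ∈ Δ
      fe-~∧  : ∀ {φ ψ} → (~ (φ ∧ ψ)) ∈ Δ → (~ φ) ∈ Δ ⊎ (~ ψ) ∈ Δ
      fe-K   : ∀ {a φ} → K a φ ∈ Δ → D φ ∈ Δ
      fe-D   : ∀ {φ} → D φ ∈ Δ → φ ∈ Δ
      fe-C   : ∀ {φ} → C φ ∈ Δ → ∀ a → K a (φ ∧ C φ) ∈ Δ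
      fe-~C  : ∀ {φ} → (~ (C φ)) ∈ Δ → ∃ λ a → (~ (K a (φ ∧ C φ))) ∈ Δ
      fe-sub : ∀ {φ ψ} → φ ∈ Δ → Sub ψ φ → IsKD ψ → ψ ∈ Δ ⊎ (~ ψ) ∈ Δ

  St : List Fm → List Fm → Set
  St Γ Δ = FullyExpanded Δ × Γ ⊆ Δ
         × ¬ (Σ (List Fm) λ Δ' → FullyExpanded Δ' × Γ ⊆ Δ' × Δ' ⊆ Δ × ¬ (Δ ⊆ Δ'))

  PatentlyConsistent : List Fm → Set
  PatentlyConsistent Δ = ¬ (Σ Fm λ χ → χ ∈ Δ × (~ χ) ∈ Δ)

  -- the prestate created by rule KR from Δ and ¬K_a φ (as a set, i.e. up to membership)
  KRSet : List Fm → Fin n → Fm → List Fm → Set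
  KRSet Δ a φ Γ = ∀ χ → (χ ∈ Γ → (χ ≡ (~ φ))
                                ⊎ (Σ Fm λ ψ → χ ≡ K a ψ × K a ψ ∈ Δ)
                                ⊎ (Σ Fm λ ψ → χ ≡ (~ (K a ψ)) × (~ (K a ψ)) ∈ Δ))
                      × ((χ ≡ (~ φ))
                                ⊎ (Σ Fm λ ψ → χ ≡ K a ψ × K a ψ ∈ Δ)
                                ⊎ (Σ Fm λ ψ → χ ≡ (~ (K a ψ)) × (~ (K a ψ)) ∈ Δ) → χ ∈ Γ)

  -- the prestate created by rule DR from Δ and ¬D φ
  DRMem : List Fm → Fm → Fm → Set
  DRMem Δ φ χ = (χ ≡ (~ φ))
              ⊎ (Σ Fm λ ψ → χ ≡ D ψ × D ψ ∈ Δ)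
              ⊎ (Σ Fm λ ψ → χ ≡ (~ (D ψ)) × (~ (D ψ)) ∈ Δ)
              ⊎ (Σ (Fin n) λ b → Σ Fm λ ψ → χ ≡ K b ψ × K b ψ ∈ Δ)
              ⊎ (Σ (Fin n) λ b → Σ Fm λ ψ → χ ≡ (~ (K b ψ)) × (~ (K b ψ)) ∈ Δ)

  DRSet : List Fm → Fm → List Fm → Set
  DRSet Δ φ Γ = ∀ χ → (χ ∈ Γ → DRMem Δ φ χ) × (DRMem Δ φ χ → χ ∈ Γ)

  mutual
    data Prestate (θ : Fm) : List Fm → Set where
      start : Prestate θ (θ ∷ [])
      kr : ∀ {Δ a φ Γ} → State θ Δ → PatentlyConsistent Δ → (~ (K a φ)) ∈ Δ
         → KRSet Δ a φ Γ → Prestate θ Γ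
      dr : ∀ {Δ φ Γ} → State θ Δ → PatentlyConsistent Δ → (~ (D φ)) ∈ Δ
         → DRSet Δ φ Γ → Prestate θ Γ

    data State (θ : Fm) : List Fm → Set where
      sr : ∀ {Γ Δ} → Prestate θ Γ → St Γ Δ → State θ Δ

  record MAEM : Set₁ where
    field
      S    : Set
      s₀   : S                       -- S nonempty
      R    : Fin n → S → S → Set
      R-eq : ∀ a → IsEquivalence (R a)
      L    : S → AP → Set            -- L(s) ⊆ AP as a predicate

    RD : S → S → Set
    RD s t = ∀ a → R a s t

    RC : S → S → Set
    RC = TransClosure (λ s t → Σ (Fin n) λ a → R a s t)

  module _ (M : MAEM) where
    open MAEM M

    _⊨_ : S → Fm → Set
    s ⊨ atom p = L s p
    s ⊨ (~ φ) = ¬ (s ⊨ φ)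
    s ⊨ (φ ∧ ψ) = (s ⊨ φ) × (s ⊨ ψ)
    s ⊨ K a φ = ∀ t → R a s t → t ⊨ φ
    s ⊨ D φ = ∀ t → RD s t → t ⊨ φ
    s ⊨ C φ = ∀ t → RC s t → t ⊨ φ

    _⊨*_ : S → List Fm → Set
    s ⊨* Γ = ∀ {φ} → φ ∈ Γ → s ⊨ φ

-- Let B be a finite set of formulas containing Γ and closed under subformulas and under the
-- unfoldings K_a φ ↦ D φ and C φ ↦ K_a (φ ∧ C φ). The formulas of B ∪ ¬B true at s form a
-- fully expanded set: each expansion rule is a valid semantic implication (for ¬C φ because
-- C φ is equivalent to ⋀_a K_a (φ ∧ C φ)), and excluded middle settles the choices.
-- This set contains Γ, and being finite it contains a minimal fully expanded extension of Γ,
-- all of whose formulas hold at s.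
module Submission where

open import Defs hiding (_⊆_)
open import Data.Nat using (ℕ; _≤_; _<_; suc; s≤s; z≤n)
open import Data.Nat.Properties using (m≤n⇒m≤1+n)
open import Data.Nat.Induction using (<-wellFounded)
open import Data.List using (List; []; _∷_; _++_; map; tabulate; concatMap; filter)
open import Data.List.Membership.Propositional using (_∈_; _∉_; find; lose)
open import Data.List.Membership.Propositional.Properties
  using (∈-++⁺ˡ; ∈-++⁺ʳ; ∈-++⁻; ∈-map⁺; ∈-map⁻; ∈-tabulate⁺; ∈-tabulate⁻;
         ∈-concatMap⁺; ∈-concatMap⁻; ∈-filter⁺; ∈-filter⁻)
open import Data.List.Relation.Binary.Subset.Propositional using (_⊆_)
open import Data.List.Relation.Binary.Subset.Propositional.Properties
  using (⊆-refl; ⊆-trans; ∈-∷⁺ʳ)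
open import Data.List.Relation.Unary.Any using (here; there)
open import Data.Product using (Σ; ∃; _×_; _,_; proj₁; proj₂)
open import Data.Sum using (_⊎_; inj₁; inj₂)
open import Data.Empty using (⊥-elim)
open import Function using (_∘_)
open import Induction.WellFounded using (Acc; acc)
open import Relation.Nullary using (¬_; yes; no)
open import Relation.Binary.PropositionalEquality using (_≢_; refl)
open import Relation.Binary.Structures using (IsEquivalence)
open import Relation.Binary.Construct.Closure.Transitive using ([_]; _∷_)
open import Level using (0ℓ)
open import Axiom.ExcludedMiddle using (ExcludedMiddle)
open import Axiom.DoubleNegationElimination using (em⇒dne)

module Minimisation (em : ExcludedMiddle 0ℓ) {A : Set} where

  ⊈⇒∃∉ : {xs ys : List A} → ¬ xs ⊆ ys → ∃ λ x → x ∈ xs × x ∉ ys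
  ⊈⇒∃∉ xs⊈ys = em⇒dne em λ none →
    xs⊈ys λ {x} x∈xs → em⇒dne em λ x∉ys → none (x , x∈xs , x∉ys)

  count∈ : List A → List A → ℕ
  count∈ [] Δ = 0
  count∈ (x ∷ U) Δ with em {x ∈ Δ}
  ... | yes _ = suc (count∈ U Δ)
  ... | no _ = count∈ U Δ

  count∈-mono : ∀ U {Δ' Δ} → Δ' ⊆ Δ → count∈ U Δ' ≤ count∈ U Δ
  count∈-mono [] Δ'⊆Δ = z≤n
  count∈-mono (x ∷ U) {Δ'} {Δ} Δ'⊆Δ with em {x ∈ Δ'} | em {x ∈ Δ}
  ... | yes _ | yes _ = s≤s (count∈-mono U Δ'⊆Δ)
  ... | yes x∈Δ' | no x∉Δ = ⊥-elim (x∉Δ (Δ'⊆Δ x∈Δ'))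
  ... | no _ | yes _ = m≤n⇒m≤1+n (count∈-mono U Δ'⊆Δ)
  ... | no _ | no _ = count∈-mono U Δ'⊆Δ

  count∈-strict : ∀ U {Δ' Δ x} → Δ' ⊆ Δ → x ∈ U → x ∈ Δ → x ∉ Δ' → count∈ U Δ' < count∈ U Δ
  count∈-strict (y ∷ U) {Δ'} {Δ} Δ'⊆Δ (here refl) x∈Δ x∉Δ' with em {y ∈ Δ'} | em {y ∈ Δ}
  ... | yes x∈Δ' | _ = ⊥-elim (x∉Δ' x∈Δ')
  ... | no _ | yes _ = s≤s (count∈-mono U Δ'⊆Δ)
  ... | no _ | no x∉Δ = ⊥-elim (x∉Δ x∈Δ)
  count∈-strict (y ∷ U) {Δ'} {Δ} Δ'⊆Δ (there x∈U) x∈Δ x∉Δ' with em {y ∈ Δ'} | em {y ∈ Δ}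
  ... | yes _ | yes _ = s≤s (count∈-strict U Δ'⊆Δ x∈U x∈Δ x∉Δ')
  ... | yes y∈Δ' | no y∉Δ = ⊥-elim (y∉Δ (Δ'⊆Δ y∈Δ'))
  ... | no _ | yes _ = m≤n⇒m≤1+n (count∈-strict U Δ'⊆Δ x∈U x∈Δ x∉Δ')
  ... | no _ | no _ = count∈-strict U Δ'⊆Δ x∈U x∈Δ x∉Δ'

  Minimal : (List A → Set) → List A → Set
  Minimal P Δ = ¬ Σ (List A) λ Δ' → P Δ' × Δ' ⊆ Δ × ¬ Δ ⊆ Δ'

  module _ (P : List A → Set) where

    -- A strictly smaller P-list misses some entry of U, so count∈ U drops along the descent.
    minimal-below : ∀ U Δ → Acc _<_ (count∈ U Δ) → P Δ → Δ ⊆ U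
                  → Σ (List A) λ Δ* → P Δ* × Minimal P Δ* × Δ* ⊆ Δ
    minimal-below U Δ (acc smaller) pΔ Δ⊆U with em {Σ (List A) λ Δ' → P Δ' × Δ' ⊆ Δ × ¬ Δ ⊆ Δ'}
    ... | no minimal = Δ , pΔ , minimal , ⊆-refl
    ... | yes (Δ' , pΔ' , Δ'⊆Δ , Δ⊈Δ') =
      let x , x∈Δ , x∉Δ' = ⊈⇒∃∉ Δ⊈Δ'
          Δ* , pΔ* , minimal , Δ*⊆Δ' =
            minimal-below U Δ' (smaller (count∈-strict U Δ'⊆Δ (Δ⊆U x∈Δ) x∈Δ x∉Δ'))
                          pΔ' (⊆-trans Δ'⊆Δ Δ⊆U)
      in Δ* , pΔ* , minimal , ⊆-trans Δ*⊆Δ' Δ'⊆Δ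

    minimal-⊆ : ∀ {Δ} → P Δ → Σ (List A) λ Δ* → P Δ* × Minimal P Δ* × Δ* ⊆ Δ
    minimal-⊆ {Δ} pΔ = minimal-below Δ Δ (<-wellFounded _) pΔ ⊆-refl

module Closure (AP : Set) (n : ℕ) where

  cl : Fm AP n → List (Fm AP n)
  cl (atom p) = atom p ∷ []
  cl (~ φ) = ~ φ ∷ cl φ
  cl (φ ∧ ψ) = φ ∧ ψ ∷ cl φ ++ cl ψ
  cl (K a φ) = K a φ ∷ D φ ∷ cl φ
  cl (D φ) = D φ ∷ cl φ
  cl (C φ) = C φ ∷ D (φ ∧ C φ) ∷ φ ∧ C φ ∷ tabulate (λ a → K a (φ ∧ C φ)) ++ cl φ

  Closed : List (Fm AP n) → Set
  Closed B = ∀ {χ} → χ ∈ B → cl χ ⊆ B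

  ∈-cl : ∀ φ → φ ∈ cl φ
  ∈-cl (atom p) = here refl
  ∈-cl (~ φ) = here refl
  ∈-cl (φ ∧ ψ) = here refl
  ∈-cl (K a φ) = here refl
  ∈-cl (D φ) = here refl
  ∈-cl (C φ) = here refl

  K-unfold∈cl : ∀ φ a → K a (φ ∧ C φ) ∈ cl (C φ)
  K-unfold∈cl φ a = there (there (there (∈-++⁺ˡ (∈-tabulate⁺ a))))

  cl⊆cl-C : ∀ φ → cl φ ⊆ cl (C φ)
  cl⊆cl-C φ m = there (there (there (∈-++⁺ʳ (tabulate (λ a → K a (φ ∧ C φ))) m)))

  Sub⇒∈cl : ∀ {ψ φ} → Sub AP n ψ φ → ψ ∈ cl φ
  Sub⇒∈cl {φ = φ} here = ∈-cl φ
  Sub⇒∈cl (sub~ s) = there (Sub⇒∈cl s)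
  Sub⇒∈cl (sub∧ˡ s) = there (∈-++⁺ˡ (Sub⇒∈cl s))
  Sub⇒∈cl (sub∧ʳ {φ = φ} s) = there (∈-++⁺ʳ (cl φ) (Sub⇒∈cl s))
  Sub⇒∈cl (subK s) = there (there (Sub⇒∈cl s))
  Sub⇒∈cl (subD s) = there (Sub⇒∈cl s)
  Sub⇒∈cl {φ = C φ} (subC s) = cl⊆cl-C φ (Sub⇒∈cl s)

  unfold⊆cl-C : ∀ φ → cl (φ ∧ C φ) ⊆ cl (C φ)
  unfold⊆cl-C φ (here refl) = there (there (here refl))
  unfold⊆cl-C φ (there m) with ∈-++⁻ (cl φ) m
  ... | inj₁ m' = cl⊆cl-C φ m'
  ... | inj₂ m' = m'

  cl-closed : ∀ φ → Closed (cl φ)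
  cl-closed (atom p) (here refl) = ⊆-refl
  cl-closed (~ φ) (here refl) = ⊆-refl
  cl-closed (~ φ) (there m) = there ∘ cl-closed φ m
  cl-closed (φ ∧ ψ) (here refl) = ⊆-refl
  cl-closed (φ ∧ ψ) (there m) with ∈-++⁻ (cl φ) m
  ... | inj₁ m' = there ∘ ∈-++⁺ˡ ∘ cl-closed φ m'
  ... | inj₂ m' = there ∘ ∈-++⁺ʳ (cl φ) ∘ cl-closed ψ m'
  cl-closed (K a φ) (here refl) = ⊆-refl
  cl-closed (K a φ) (there (here refl)) = there
  cl-closed (K a φ) (there (there m)) = there ∘ there ∘ cl-closed φ m
  cl-closed (D φ) (here refl) = ⊆-refl
  cl-closed (D φ) (there m) = there ∘ cl-closed φ m
  cl-closed (C φ) (here refl) = ⊆-refl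
  cl-closed (C φ) (there (here refl)) = ∈-∷⁺ʳ (there (here refl)) (unfold⊆cl-C φ)
  cl-closed (C φ) (there (there (here refl))) = unfold⊆cl-C φ
  cl-closed (C φ) (there (there (there m))) with ∈-++⁻ (tabulate (λ a → K a (φ ∧ C φ))) m
  ... | inj₂ m' = ⊆-trans (cl-closed φ m') (cl⊆cl-C φ)
  ... | inj₁ k with ∈-tabulate⁻ k
  ...   | a , refl = ∈-∷⁺ʳ (K-unfold∈cl φ a) (∈-∷⁺ʳ (there (here refl)) (unfold⊆cl-C φ))

  cl* : List (Fm AP n) → List (Fm AP n)
  cl* = concatMap cl

  ⊆-cl* : ∀ Γ → Γ ⊆ cl* Γ
  ⊆-cl* Γ γ∈Γ = ∈-concatMap⁺ cl (lose γ∈Γ (∈-cl _))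

  cl*-closed : ∀ Γ → Closed (cl* Γ)
  cl*-closed Γ m with find (∈-concatMap⁻ cl {xs = Γ} m)
  ... | γ , γ∈Γ , χ∈cl-γ = ∈-concatMap⁺ cl ∘ lose γ∈Γ ∘ cl-closed γ χ∈cl-γ

module Semantics (AP : Set) (n : ℕ) (M : MAEM AP n) where
  open MAEM M

  infix 4 _⊩_
  _⊩_ : S → Fm AP n → Set
  _⊩_ = _⊨_ AP n M

  ⊩D⇒⊩ : ∀ {s} φ → s ⊩ D φ → s ⊩ φ
  ⊩D⇒⊩ {s} _ s⊩Dφ = s⊩Dφ s (λ a → IsEquivalence.refl (R-eq a))

  ⊩K⇒⊩D : ∀ {s a} φ → s ⊩ K a φ → s ⊩ D φ
  ⊩K⇒⊩D {a = a} _ s⊩Kφ t s-D-t = s⊩Kφ t (s-D-t a)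

  ⊩C⇒⊩K : ∀ {s} φ → s ⊩ C φ → ∀ a → s ⊩ K a (φ ∧ C φ)
  ⊩C⇒⊩K _ s⊩Cφ a t s-a-t = s⊩Cφ t [ a , s-a-t ] , λ u t-C-u → s⊩Cφ u ((a , s-a-t) ∷ t-C-u)

  ⊩K⇒⊩C : ∀ {s} φ → (∀ a → s ⊩ K a (φ ∧ C φ)) → s ⊩ C φ
  ⊩K⇒⊩C _ s⊩K t [ a , s-a-t ] = proj₁ (s⊩K a t s-a-t)
  ⊩K⇒⊩C _ s⊩K u ((a , s-a-t) ∷ t-C-u) = proj₂ (s⊩K a _ s-a-t) u t-C-u

  ⊮C⇒⊮K : ExcludedMiddle 0ℓ → ∀ {s} φ → ¬ s ⊩ C φ
        → ∃ λ a → ¬ s ⊩ K a (φ ∧ C φ)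
  ⊮C⇒⊮K em φ s⊮Cφ = em⇒dne em λ none →
    s⊮Cφ (⊩K⇒⊩C φ λ a → em⇒dne em λ s⊮K → none (a , s⊮K))

module Truths (em : ExcludedMiddle 0ℓ) (AP : Set) (n : ℕ) (M : MAEM AP n) (s : MAEM.S M) where
  open Closure AP n
  open Semantics AP n M

  truths : List (Fm AP n) → List (Fm AP n)
  truths B = filter (λ φ → em {s ⊩ φ}) (B ++ map ~_ B)

  truths-sound : ∀ B {φ} → φ ∈ truths B → s ⊩ φ
  truths-sound B m = proj₂ (∈-filter⁻ (λ φ → em {s ⊩ φ}) {xs = B ++ map ~_ B} m)

  module _ {B : List (Fm AP n)} (closed : Closed B) where

    private
      B± = B ++ map ~_ B

      keep : ∀ {φ} → φ ∈ B± → s ⊩ φ → φ ∈ truths B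
      keep = ∈-filter⁺ (λ φ → em {s ⊩ φ})

      pos : ∀ {φ} → φ ∈ B → φ ∈ B±
      pos = ∈-++⁺ˡ

      neg : ∀ {φ} → φ ∈ B → ~ φ ∈ B±
      neg = ∈-++⁺ʳ B ∘ ∈-map⁺ ~_

      split : ∀ {φ} → φ ∈ truths B → φ ∈ B± × s ⊩ φ
      split = ∈-filter⁻ (λ φ → em {s ⊩ φ}) {xs = B±}

      sub : ∀ {φ ψ} → φ ∈ B → Sub AP n ψ φ → ψ ∈ B
      sub φ∈B ψ≤φ = closed φ∈B (Sub⇒∈cl ψ≤φ)

      unnegated : ∀ {φ} → (∀ ψ → φ ≢ ~ ψ) → φ ∈ B± → φ ∈ B
      unnegated not-neg m with ∈-++⁻ B m
      ... | inj₁ φ∈B = φ∈B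
      ... | inj₂ m' with ∈-map⁻ ~_ m'
      ...   | ψ , _ , φ≡~ψ = ⊥-elim (not-neg ψ φ≡~ψ)

      negated : ∀ {φ} → ~ φ ∈ B± → φ ∈ B
      negated m with ∈-++⁻ B m
      ... | inj₁ ~φ∈B = sub ~φ∈B (sub~ here)
      ... | inj₂ m' with ∈-map⁻ ~_ m'
      ...   | _ , φ∈B , refl = φ∈B

      KD-sub : ∀ {φ ψ} → φ ∈ B± → Sub AP n ψ φ → IsKD AP n ψ → ψ ∈ B
      KD-sub m ψ≤φ kd with ∈-++⁻ B m
      ... | inj₁ φ∈B = sub φ∈B ψ≤φ
      ... | inj₂ m' with ∈-map⁻ ~_ m'
      KD-sub m here () | inj₂ m' | _ , _ , refl
      KD-sub m (sub~ ψ≤φ) kd | inj₂ m' | _ , φ∈B , refl = sub φ∈B ψ≤φ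

      decide : ∀ {φ} → φ ∈ B → φ ∈ truths B ⊎ ~ φ ∈ truths B
      decide {φ} φ∈B with em {s ⊩ φ}
      ... | yes s⊩φ = inj₁ (keep (pos φ∈B) s⊩φ)
      ... | no s⊮φ = inj₂ (keep (neg φ∈B) s⊮φ)

      expand-~∧ : ∀ {φ ψ} → ~ (φ ∧ ψ) ∈ truths B → ~ φ ∈ truths B ⊎ ~ ψ ∈ truths B
      expand-~∧ {φ} {ψ} m with split m | em {s ⊩ φ}
      ... | ~φ∧ψ∈B± , _ | no s⊮φ =
        inj₁ (keep (neg (sub (negated ~φ∧ψ∈B±) (sub∧ˡ here))) s⊮φ)
      ... | ~φ∧ψ∈B± , s⊮φ∧ψ | yes s⊩φ =
        inj₂ (keep (neg (sub (negated ~φ∧ψ∈B±) (sub∧ʳ here))) λ s⊩ψ → s⊮φ∧ψ (s⊩φ , s⊩ψ))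

    truths-fullyExpanded : FullyExpanded AP n (truths B)
    truths-fullyExpanded = record
      { fe-~~ = λ m → let c , t = split m in
          keep (pos (sub (negated c) (sub~ here))) (em⇒dne em t)
      ; fe-∧ = λ m → let c , t = split m; b = unnegated (λ _ ()) c in
          keep (pos (sub b (sub∧ˡ here))) (proj₁ t) , keep (pos (sub b (sub∧ʳ here))) (proj₂ t)
      ; fe-~∧ = expand-~∧
      ; fe-K = λ {φ = φ} m → let c , t = split m in
          keep (pos (closed (unnegated (λ _ ()) c) (there (here refl)))) (⊩K⇒⊩D φ t)
      ; fe-D = λ {φ} m → let c , t = split m in
          keep (pos (sub (unnegated (λ _ ()) c) (subD here))) (⊩D⇒⊩ φ t)
      ; fe-C = λ {φ} m a → let c , t = split m in
          keep (pos (closed (unnegated (λ _ ()) c) (K-unfold∈cl φ a))) (⊩C⇒⊩K φ t a)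
      ; fe-~C = λ {φ} m → let c , t = split m; a , s⊮K = ⊮C⇒⊮K em φ t in
          a , keep (neg (closed (negated c) (K-unfold∈cl φ a))) s⊮K
      ; fe-sub = λ m ψ≤φ kd → decide (KD-sub (proj₁ (split m)) ψ≤φ kd)
      }

    ⊆-truths : ∀ {Γ} → Γ ⊆ B → _⊨*_ AP n M s Γ → Γ ⊆ truths B
    ⊆-truths Γ⊆B s⊩Γ φ∈Γ = keep (pos (Γ⊆B φ∈Γ)) (s⊩Γ φ∈Γ)

lemma3 : ExcludedMiddle 0ℓ
    → (AP : Set) → AP → (n : ℕ) → 2 ≤ n
    → (θ : Fm AP n) (Γ : List (Fm AP n)) → Prestate AP n θ Γ
    → (M : MAEM AP n) (s : MAEM.S M) → _⊨*_ AP n M s Γ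
    → Σ (List (Fm AP n)) λ Δ → St AP n Γ Δ × _⊨*_ AP n M s Δ
lemma3 em AP _ n _ _ Γ _ M s s⊩Γ =
  let open Closure AP n
      open Truths em AP n M s
      Δ , (feΔ , Γ⊆Δ) , minimal , Δ⊆truths =
        Minimisation.minimal-⊆ em (λ Δ → FullyExpanded AP n Δ × Γ ⊆ Δ)
          ( truths-fullyExpanded (cl*-closed Γ)
          , ⊆-truths (cl*-closed Γ) (⊆-cl* Γ) s⊩Γ )
  in Δ
   , (feΔ , Γ⊆Δ , λ (Δ' , feΔ' , Γ⊆Δ' , rest) → minimal (Δ' , (feΔ' , Γ⊆Δ') , rest))
   , λ φ∈Δ → truths-sound (cl* Γ) (Δ⊆truths φ∈Δ)
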